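{- Let $X$ be a finite non-empty set and $P\in\mathfrak{P}(X)$ a poset having an FPP-graph with height $h_P\geq 3$. Then there exists a chain $P=Q_0\sqsupset Q_1\sqsupset\cdots\sqsupset Q_I$ in $\mathfrak{P}(X)$ such that for all $1\leq i\leq I$, $Q_i$ is a lower cover of $Q_{i-1}$ in $(\mathfrak{P}(X),\sqsubseteq)$ and $Q_i$ has an FPP-graph; for all $0\leq i\leq I-1$, $h_{Q_i}\geq 3$; and $h_{Q_I}=2$.
   Context: $\mathfrak{P}(X)$ is the set of all posets with carrier $X$, ordered by $P\sqsubseteq Q$ iff $\leq_P\subseteq\leq_Q$. The height $h_P$ of a poset $P$ is the maximum length $I$ of a chain $z_0<_P z_1<_P\cdots<_P z_I$. For a poset $P$: $[x,y]_P=\{z: x\leq_P z\leq_P y\}$; $L(P)$, $U(P)$ are the sets of minimal and maximal elements, $M(P)=X\setminus(L(P)\cup U(P))$; $\prec_P=\{(a,b)\in<_P: M(P)\cap[a,b]_P=\emptyset\}$. $P\setminus(a,b)=(X,\leq_P\setminus\{(a,b)\})$. $P$ is connected iff its comparability graph is connected. $P$ has an FPP-graph iff $P$ is connected and $P\setminus(a,b)$ is disconnected for every $(a,b)\in\prec_P$. -}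

module Defs where

open import Data.Nat using (ℕ; zero; suc; _≤_)
open import Data.Fin using (Fin; zero; suc; inject₁; _≟_)
open import Data.Bool using (Bool; true; false; if_then_else_; _∧_)
open import Data.Product using (Σ; ∃; _×_; _,_; proj₁)
open import Data.Sum using (_⊎_)
open import Relation.Nullary using (¬_; does)
open import Relation.Binary.PropositionalEquality using (_≡_; _≢_)

Rel : ℕ → Set
Rel n = Fin n → Fin n → Bool

_∋_≤_ : ∀ {n} → Rel n → Fin n → Fin n → Set
R ∋ x ≤ y = R x y ≡ true

_∋_<_ : ∀ {n} → Rel n → Fin n → Fin n → Set
R ∋ x < y = (R ∋ x ≤ y) × x ≢ y

record IsPartialOrder {n : ℕ} (R : Rel n) : Set where
  field
    refl    : ∀ x → R ∋ x ≤ x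
    antisym : ∀ x y → R ∋ x ≤ y → R ∋ y ≤ x → x ≡ y
    trans   : ∀ x y z → R ∋ x ≤ y → R ∋ y ≤ z → R ∋ x ≤ z

PosetOn : ℕ → Set
PosetOn n = Σ (Rel n) IsPartialOrder

rel : ∀ {n} → PosetOn n → Rel n
rel = proj₁

_⊑_ : ∀ {n} → PosetOn n → PosetOn n → Set
P ⊑ Q = ∀ x y → rel P ∋ x ≤ y → rel Q ∋ x ≤ y

_⊏_ : ∀ {n} → PosetOn n → PosetOn n → Set
P ⊏ Q = P ⊑ Q × ¬ (Q ⊑ P)

LowerCover : ∀ {n} → PosetOn n → PosetOn n → Set
LowerCover {n} Q P = Q ⊏ P × (∀ (R : PosetOn n) → ¬ (Q ⊏ R × R ⊏ P))

HasChain : ∀ {n} → PosetOn n → ℕ → Set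
HasChain {n} P I = Σ (Fin (suc I) → Fin n) λ z → ∀ (i : Fin I) → rel P ∋ z (inject₁ i) < z (suc i)

Height : ∀ {n} → PosetOn n → ℕ → Set
Height P h = HasChain P h × (∀ m → HasChain P m → m ≤ h)

Minimal : ∀ {n} → PosetOn n → Fin n → Set
Minimal {n} P x = ∀ (y : Fin n) → rel P ∋ y ≤ x → y ≡ x

Maximal : ∀ {n} → PosetOn n → Fin n → Set
Maximal {n} P x = ∀ (y : Fin n) → rel P ∋ x ≤ y → y ≡ x

InM : ∀ {n} → PosetOn n → Fin n → Set
InM P z = ¬ Minimal P z × ¬ Maximal P z

Prec : ∀ {n} → PosetOn n → Fin n → Fin n → Set
Prec {n} P a b = (rel P ∋ a < b) ×
  (∀ (z : Fin n) → rel P ∋ a ≤ z → rel P ∋ z ≤ b → ¬ InM P z)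

remove : ∀ {n} → Rel n → Fin n → Fin n → Rel n
remove R a b x y = if does (x ≟ a) ∧ does (y ≟ b) then false else R x y

Comparable : ∀ {n} → Rel n → Fin n → Fin n → Set
Comparable R x y = (R ∋ x ≤ y) ⊎ (R ∋ y ≤ x)

data Reach {n : ℕ} (R : Rel n) : Fin n → Fin n → Set where
  here : ∀ {x} → Reach R x x
  step : ∀ {x y z} → Comparable R x y → Reach R y z → Reach R x z

Connected : ∀ {n} → Rel n → Set
Connected {n} R = ∀ (x y : Fin n) → Reach R x y

HasFPPGraph : ∀ {n} → PosetOn n → Set
HasFPPGraph {n} P = Connected (rel P) ×
  (∀ (a b : Fin n) → Prec P a b → ¬ Connected (remove (rel P) a b))

_≐_ : ∀ {n} → PosetOn n → PosetOn n → Set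
P ≐ Q = ∀ x y → rel P x y ≡ rel Q x y

-- Let z₀ <_P z₁ <_P z₂ <_P z₃ <_P ⋯ be a chain of maximum length. Since no longer chain exists,
-- z₂ covers z₁, so deleting the single pair (z₁ , z₂) from ≤_P leaves a partial order, and it is
-- a lower cover of P. Through z₀ and z₃ both z₁ and z₂ stay in the middle set M, and P stays
-- connected along z₁ ≤ z₃ ≥ z₂; hence every pair of ≺ of the new poset already lay in ≺_P, and
-- removing it disconnects P, a fortiori the smaller order. The new poset still has the chain
-- z₀ < z₁ < z₃, so its height is at least 2. Iterating terminates because ⊏ is well-founded on
-- the finite set 𝔓(X), and it stops exactly when the height drops to 2.
module Submission where

open import Defs
open import Data.Nat using (ℕ; zero; suc; _≤_; _<_; _*_; z≤n; s≤s)
open import Data.Nat.Properties using (≤-trans; n≤1+n; n≤0⇒n≡0; ≤∧≢⇒<; ≤-pred; 1+n≰n)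
open import Data.Fin using (Fin; zero; suc; inject₁; fromℕ; _≟_; combine; remQuot)
open import Data.Fin.Properties using (any?; ¬∀⟶∃¬; remQuot-combine)
open import Data.Fin.Subset using (Subset; _∈_; _⊆_; _⊂_)
open import Data.Fin.Subset.Properties using (_∈?_)
open import Data.Fin.Subset.Induction using (⊂-wellFounded)
open import Data.Vec using (tabulate)
open import Data.Vec.Properties using (lookup∘tabulate; []=⇒lookup; lookup⇒[]=)
open import Data.Vec.Functional using (Vector; []; _∷_)
import Data.Bool.Properties as Bool
open import Data.Product using (Σ; ∃; _×_; _,_; proj₁; proj₂; uncurry)
open import Data.Sum using (_⊎_; inj₁; inj₂; swap; [_,_]′)
import Data.Sum as Sum
open import Data.Bool using (true; false)
open import Data.Empty using (⊥; ⊥-elim)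
open import Function using (_∘_)
open import Induction.WellFounded using (WellFounded; Acc; acc; module Subrelation)
open import Relation.Binary.Construct.On as On using ()
open import Relation.Nullary using (¬_; Dec; yes; no)
open import Relation.Nullary.Decidable using (_×-dec_; _→-dec_; ¬?)
open import Relation.Unary using (Pred; Decidable)
open import Relation.Binary.PropositionalEquality using (_≡_; _≢_; refl; sym; trans; subst)

_⊆₂_ : ∀ {n} → Rel n → Rel n → Set
R ⊆₂ S = ∀ x y → R ∋ x ≤ y → S ∋ x ≤ y

greatest : ∀ {p} {A : Pred ℕ p} → Decidable A → ∀ B → (∀ m → A m → m ≤ B) →
           ∀ {m} → A m → ∃ λ h → A h × (∀ m → A m → m ≤ h)
greatest A? B bounded a with A? B
... | yes aB = B , aB , bounded
greatest {A = A} A? zero bounded {m} a | no ¬a0 = ⊥-elim (¬a0 (subst A (n≤0⇒n≡0 (bounded m a)) a))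
greatest A? (suc B) bounded a | no ¬aB =
  greatest A? B (λ m am → ≤-pred (≤∧≢⇒< (bounded m am) λ { refl → ¬aB am })) a

Reach-trans : ∀ {n} {R : Rel n} {x y z} → Reach R x y → Reach R y z → Reach R x z
Reach-trans here r = r
Reach-trans (step c r) r′ = step c (Reach-trans r r′)

Reach-sym : ∀ {n} {R : Rel n} {x y} → Reach R x y → Reach R y x
Reach-sym here = here
Reach-sym (step c r) = Reach-trans (Reach-sym r) (step (swap c) here)

Reach-concatMap : ∀ {n} {R S : Rel n} → (∀ {p q} → Comparable R p q → Reach S p q) →
                  ∀ {x y} → Reach R x y → Reach S x y
Reach-concatMap f here = here
Reach-concatMap f (step c r) = Reach-trans (f c) (Reach-concatMap f r)

Reach-mono : ∀ {n} {R S : Rel n} → R ⊆₂ S → ∀ {x y} → Reach R x y → Reach S x y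
Reach-mono R⊆S = Reach-concatMap λ c → step (Sum.map (R⊆S _ _) (R⊆S _ _) c) here

module _ {n} (R : Rel n) (a b : Fin n) where

  remove-⊆₂ : remove R a b ⊆₂ R
  remove-⊆₂ p q with p ≟ a | q ≟ b
  ... | yes _ | yes _ = λ ()
  ... | yes _ | no _  = λ h → h
  ... | no _  | _     = λ h → h

  remove-removes : remove R a b a b ≡ false
  remove-removes with a ≟ a | b ≟ b
  ... | yes _ | yes _ = refl
  ... | yes _ | no b≢b = ⊥-elim (b≢b refl)
  ... | no a≢a | _ = ⊥-elim (a≢a refl)

  remove-keepsˡ : ∀ {p q} → R ∋ p ≤ q → p ≢ a → remove R a b ∋ p ≤ q
  remove-keepsˡ {p} h p≢a with p ≟ a
  ... | yes p≡a = ⊥-elim (p≢a p≡a)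
  ... | no _ = h

  remove-keepsʳ : ∀ {p q} → R ∋ p ≤ q → q ≢ b → remove R a b ∋ p ≤ q
  remove-keepsʳ {p} {q} h q≢b with p ≟ a | q ≟ b
  ... | yes _ | yes q≡b = ⊥-elim (q≢b q≡b)
  ... | yes _ | no _ = h
  ... | no _ | _ = h

  remove-split : ∀ {p q} → R ∋ p ≤ q → (p ≡ a × q ≡ b) ⊎ (remove R a b ∋ p ≤ q)
  remove-split {p} {q} h with p ≟ a | q ≟ b
  ... | yes p≡a | yes q≡b = inj₁ (p≡a , q≡b)
  ... | yes _ | no _ = inj₂ h
  ... | no _ | _ = inj₂ h

remove-mono : ∀ {n} {R S : Rel n} a b → R ⊆₂ S → remove R a b ⊆₂ remove S a b
remove-mono a b R⊆S p q with p ≟ a | q ≟ b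
... | yes _ | yes _ = λ ()
... | yes _ | no _  = R⊆S p q
... | no _  | _     = R⊆S p q

-- Encoding a relation as a subset of Fin n × Fin n ≅ Fin (n * n) turns ⊏ into strict inclusion.
graph : ∀ {n} → Rel n → Subset (n * n)
graph {n} R = tabulate (uncurry R ∘ remQuot n)

module _ {n} {R : Rel n} where

  ∈-graph⁺ : ∀ {k} → uncurry R (remQuot n k) ≡ true → k ∈ graph R
  ∈-graph⁺ {k} e = lookup⇒[]= k _ (trans (lookup∘tabulate _ k) e)

  ∈-graph⁻ : ∀ {k} → k ∈ graph R → uncurry R (remQuot n k) ≡ true
  ∈-graph⁻ {k} k∈R = trans (sym (lookup∘tabulate _ k)) ([]=⇒lookup k∈R)

  combine-∈-graph⁺ : ∀ {x y} → R ∋ x ≤ y → combine x y ∈ graph R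
  combine-∈-graph⁺ {x} {y} h = ∈-graph⁺ (subst (λ xy → uncurry R xy ≡ true) (sym (remQuot-combine x y)) h)

  combine-∈-graph⁻ : ∀ {x y} → combine x y ∈ graph R → R ∋ x ≤ y
  combine-∈-graph⁻ {x} {y} k∈R = subst (λ xy → uncurry R xy ≡ true) (remQuot-combine x y) (∈-graph⁻ k∈R)

graph-mono : ∀ {n} {R S : Rel n} → R ⊆₂ S → graph R ⊆ graph S
graph-mono {R = R} {S} R⊆S k∈R = ∈-graph⁺ {R = S} (R⊆S _ _ (∈-graph⁻ {R = R} k∈R))

graph-reflects-⊆ : ∀ {n} {R S : Rel n} → graph R ⊆ graph S → R ⊆₂ S
graph-reflects-⊆ {R = R} {S} R⊆S x y h = combine-∈-graph⁻ {R = S} (R⊆S (combine-∈-graph⁺ {R = R} h))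

graph-⊏ : ∀ {n} {P Q : PosetOn n} → P ⊏ Q → graph (rel P) ⊂ graph (rel Q)
graph-⊏ {n} {P} {Q} (P⊑Q , Q⋢P) = graph-mono P⊑Q , k , k∈Q , k∉P
  where
  Q⊆P? : Decidable λ k → k ∈ graph (rel Q) → k ∈ graph (rel P)
  Q⊆P? k = (k ∈? _) →-dec (k ∈? _)
  counterexample : ∃ λ k → ¬ (k ∈ graph (rel Q) → k ∈ graph (rel P))
  counterexample = ¬∀⟶∃¬ (n * n) _ Q⊆P? λ Q⊆P → Q⋢P (graph-reflects-⊆ λ {k} → Q⊆P k)
  k : Fin (n * n)
  k = proj₁ counterexample
  k∉P : ¬ k ∈ graph (rel P)
  k∉P k∈P = proj₂ counterexample λ _ → k∈P
  k∈Q : k ∈ graph (rel Q)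
  k∈Q with k ∈? graph (rel Q)
  ... | yes k∈Q = k∈Q
  ... | no k∉Q = ⊥-elim (proj₂ counterexample λ k∈Q → ⊥-elim (k∉Q k∈Q))

⊏-wellFounded : ∀ {n} → WellFounded (_⊏_ {n})
⊏-wellFounded {n} = Subrelation.wellFounded (λ {P} {Q} → graph-⊏ {n} {P} {Q})
                                            (On.wellFounded (graph {n} ∘ rel) ⊂-wellFounded)

⊑-HasChain : ∀ {n} {P Q : PosetOn n} → P ⊑ Q → ∀ {m} → HasChain P m → HasChain Q m
⊑-HasChain P⊑Q (z , z<) = z , λ i → P⊑Q _ _ (proj₁ (z< i)) , proj₂ (z< i)

ChainFrom : ∀ {n} → PosetOn n → ℕ → Fin n → Set
ChainFrom {n} P m x = Σ (Fin (suc m) → Fin n) λ z → (z zero ≡ x) × (∀ i → rel P ∋ z (inject₁ i) < z (suc i))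

module _ {n} (P : PosetOn n) where

  <? : ∀ x y → Dec (rel P ∋ x < y)
  <? x y = (rel P x y Bool.≟ true) ×-dec ¬? (x ≟ y)

  chainFrom? : ∀ m x → Dec (ChainFrom P m x)
  chainFrom? zero x = yes ((λ _ → x) , refl , λ ())
  chainFrom? (suc m) x with any? (λ y → <? x y ×-dec chainFrom? m y)
  ... | yes (y , x<y , z , refl , z<) = yes (x ∷ z , refl , λ { zero → x<y ; (suc i) → z< i })
  ... | no ∄y = no λ { (z , refl , z<) → ∄y (z (suc zero) , z< zero , z ∘ suc , refl , z< ∘ suc) }

  hasChain? : ∀ m → Dec (HasChain P m)
  hasChain? m with any? (chainFrom? m)
  ... | yes (_ , z , _ , z<) = yes (z , z<)
  ... | no ∄x = no λ (z , z<) → ∄x (z zero , z , refl , z<)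

  Height-exists : ∀ B → (∀ m → HasChain P m → m ≤ B) → ∀ {m} → HasChain P m → ∃ (Height P)
  Height-exists = greatest hasChain?

Cover : ∀ {n} → PosetOn n → Fin n → Fin n → Set
Cover {n} P x y = (rel P ∋ x < y) × (∀ (w : Fin n) → rel P ∋ x < w → ¬ (rel P ∋ w < y))

maximumChain-cover : ∀ {n k} (P : PosetOn n) (z : Fin (suc (suc (suc k))) → Fin n) →
                     (∀ i → rel P ∋ z (inject₁ i) < z (suc i)) → (∀ m → HasChain P m → m ≤ suc (suc k)) →
                     Cover P (z (suc zero)) (z (suc (suc zero)))
maximumChain-cover P z z< maximum = z< (suc zero) , λ w x<w w<y →
  1+n≰n (maximum _ (z zero ∷ z (suc zero) ∷ w ∷ (λ i → z (suc (suc i))) ,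
                     λ { zero → z< zero ; (suc zero) → x<w ; (suc (suc zero)) → w<y
                       ; (suc (suc (suc i))) → z< (suc (suc i)) }))

module RemoveCover {n} (P : PosetOn n) {x y} (x⋖y : Cover P x y) where

  private
    module ≤ = IsPartialOrder (proj₂ P)
    R : Rel n
    R = rel P
    R⁻ : Rel n
    R⁻ = remove R x y
    x<y : R ∋ x < y
    x<y = proj₁ x⋖y

  x≰⁻y : ¬ (R⁻ ∋ x ≤ y)
  x≰⁻y x≤⁻y with () ← trans (sym x≤⁻y) (remove-removes R x y)

  nothing-between : ∀ w → R⁻ ∋ x ≤ w → ¬ (R⁻ ∋ w ≤ y)
  nothing-between w x≤⁻w w≤⁻y = cases (w ≟ x) (w ≟ y)
    where
    cases : Dec (w ≡ x) → Dec (w ≡ y) → ⊥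
    cases (yes refl) _ = x≰⁻y w≤⁻y
    cases _ (yes refl) = x≰⁻y x≤⁻w
    cases (no w≢x) (no w≢y) =
      proj₂ x⋖y w (remove-⊆₂ R x y x w x≤⁻w , w≢x ∘ sym) (remove-⊆₂ R x y w y w≤⁻y , w≢y)

  isPartialOrder : IsPartialOrder R⁻
  isPartialOrder = record
    { refl    = λ p → [ (λ { (refl , p≡y) → ⊥-elim (proj₂ x<y p≡y) }) , (λ p≤⁻p → p≤⁻p) ]′
                        (remove-split R x y (≤.refl p))
    ; antisym = λ p q p≤⁻q q≤⁻p → ≤.antisym p q (remove-⊆₂ R x y p q p≤⁻q) (remove-⊆₂ R x y q p q≤⁻p)
    ; trans   = trans⁻
    }
    where
    trans⁻ : ∀ p q r → R⁻ ∋ p ≤ q → R⁻ ∋ q ≤ r → R⁻ ∋ p ≤ r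
    trans⁻ p q r p≤⁻q q≤⁻r
      with remove-split R x y (≤.trans p q r (remove-⊆₂ R x y p q p≤⁻q) (remove-⊆₂ R x y q r q≤⁻r))
    ... | inj₁ (refl , refl) = ⊥-elim (nothing-between q p≤⁻q q≤⁻r)
    ... | inj₂ p≤⁻r = p≤⁻r

  P⁻ : PosetOn n
  P⁻ = R⁻ , isPartialOrder

  lowerCover : LowerCover P⁻ P
  lowerCover = (remove-⊆₂ R x y , λ P⊑P⁻ → x≰⁻y (P⊑P⁻ x y (proj₁ x<y))) , no-poset-between
    where
    no-poset-between : ∀ S → ¬ (P⁻ ⊏ S × S ⊏ P)
    no-poset-between S ((P⁻⊑S , S⋢P⁻) , (S⊑P , P⋢S)) with rel S x y Bool.≟ true
    ... | yes x≤ˢy = P⋢S λ p q p≤q → [ (λ { (refl , refl) → x≤ˢy }) , P⁻⊑S p q ]′ (remove-split R x y p≤q)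
    ... | no x≰ˢy = S⋢P⁻ λ p q p≤ˢq →
      [ (λ { (refl , refl) → ⊥-elim (x≰ˢy p≤ˢq) }) , (λ p≤⁻q → p≤⁻q) ]′ (remove-split R x y (S⊑P p q p≤ˢq))

  module _ {u v} (u<x : R ∋ u < x) (y<v : R ∋ y < v) where

    private
      u≤⁻x : R⁻ ∋ u ≤ x
      u≤⁻x = remove-keepsˡ R x y (proj₁ u<x) (proj₂ u<x)

      u≤⁻y : R⁻ ∋ u ≤ y
      u≤⁻y = remove-keepsˡ R x y (≤.trans u x y (proj₁ u<x) (proj₁ x<y)) (proj₂ u<x)

      x≤⁻v : R⁻ ∋ x ≤ v
      x≤⁻v = remove-keepsʳ R x y (≤.trans x y v (proj₁ x<y) (proj₁ y<v)) (proj₂ y<v ∘ sym)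

      y≤⁻v : R⁻ ∋ y ≤ v
      y≤⁻v = remove-keepsˡ R x y (proj₁ y<v) (proj₂ x<y ∘ sym)

      u≢y : u ≢ y
      u≢y refl = proj₂ u<x (≤.antisym u x (proj₁ u<x) (proj₁ x<y))

      x≢v : x ≢ v
      x≢v refl = proj₂ x<y (≤.antisym x y (proj₁ x<y) (proj₁ y<v))

    chain : HasChain P⁻ 2
    chain = u ∷ x ∷ v ∷ [] , λ { zero → u≤⁻x , proj₂ u<x ; (suc zero) → x≤⁻v , x≢v }

    x∈M : InM P⁻ x
    x∈M = (λ min → proj₂ u<x (min u u≤⁻x)) , (λ max → x≢v (sym (max v x≤⁻v)))

    y∈M : InM P⁻ y
    y∈M = (λ min → u≢y (min u u≤⁻y)) , (λ max → proj₂ y<v (sym (max v y≤⁻v)))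

    InM-preserved : ∀ t → InM P t → InM P⁻ t
    InM-preserved t (¬min , ¬max) = cases (t ≟ x) (t ≟ y)
      where
      cases : Dec (t ≡ x) → Dec (t ≡ y) → InM P⁻ t
      cases (yes refl) _ = x∈M
      cases _ (yes refl) = y∈M
      cases (no t≢x) (no t≢y) =
        (λ min⁻ → ¬min λ w w≤t → min⁻ w (remove-keepsʳ R x y w≤t t≢y)) ,
        (λ max⁻ → ¬max λ w t≤w → max⁻ w (remove-keepsˡ R x y t≤w t≢x))

    -- The removed edge x — y is bridged by x ≤ v ≥ y.
    ≤⇒Reach⁻ : ∀ {p q} → R ∋ p ≤ q → Reach R⁻ p q
    ≤⇒Reach⁻ p≤q with remove-split R x y p≤q
    ... | inj₁ (refl , refl) = step (inj₁ x≤⁻v) (step (inj₂ y≤⁻v) here)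
    ... | inj₂ p≤⁻q = step (inj₁ p≤⁻q) here

    connected : Connected R → Connected R⁻
    connected conn p q = Reach-concatMap [ ≤⇒Reach⁻ , Reach-sym ∘ ≤⇒Reach⁻ ]′ (conn p q)

    Prec⁻⇒Prec : ∀ a b → Prec P⁻ a b → Prec P a b
    Prec⁻⇒Prec a b (a<⁻b , outsideM⁻) =
      (remove-⊆₂ R x y a b (proj₁ a<⁻b) , proj₂ a<⁻b) ,
      λ t a≤t t≤b t∈M → outsideM⁻ t (remove-keepsˡ R x y a≤t a≢x) (remove-keepsʳ R x y t≤b b≢y)
                                     (InM-preserved t t∈M)
      where
      a≢x : a ≢ x
      a≢x refl = outsideM⁻ x (IsPartialOrder.refl isPartialOrder x) (proj₁ a<⁻b) x∈M
      b≢y : b ≢ y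
      b≢y refl = outsideM⁻ y (proj₁ a<⁻b) (IsPartialOrder.refl isPartialOrder y) y∈M

    hasFPPGraph : HasFPPGraph P → HasFPPGraph P⁻
    hasFPPGraph (conn , disconnects) = connected conn , λ a b ab conn⁻ →
      disconnects a b (Prec⁻⇒Prec a b ab)
        λ p q → Reach-mono (remove-mono a b (remove-⊆₂ R x y)) (conn⁻ p q)

lowerCover-withFPPGraph : ∀ {n k} (P : PosetOn n) → HasFPPGraph P → Height P (suc (suc (suc k))) →
                          ∃ λ Q → LowerCover Q P × HasFPPGraph Q × ∃ λ h → Height Q h × 2 ≤ h
lowerCover-withFPPGraph {k = k} P fpp ((z , z<) , maximum) =
  P⁻ , lowerCover , hasFPPGraph u<x y<v fpp , h , height , proj₂ height 2 (chain u<x y<v)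
  where
  open RemoveCover P (maximumChain-cover P z z< maximum)
  u<x : rel P ∋ z zero < z (suc zero)
  u<x = z< zero
  y<v : rel P ∋ z (suc (suc zero)) < z (suc (suc (suc zero)))
  y<v = z< (suc (suc zero))
  P⁻-bounded : ∀ m → HasChain P⁻ m → m ≤ suc (suc (suc k))
  P⁻-bounded m c = maximum m (⊑-HasChain {P = P⁻} {Q = P} (proj₁ (proj₁ lowerCover)) c)
  P⁻-height : ∃ (Height P⁻)
  P⁻-height = Height-exists P⁻ _ P⁻-bounded (chain u<x y<v)
  h : ℕ
  h = proj₁ P⁻-height
  height : Height P⁻ h
  height = proj₂ P⁻-height

Descent : ∀ {n} → PosetOn n → Set
Descent {n} P = Σ ℕ λ I → Σ (Vector (PosetOn n) I) λ Qs → let Q = P ∷ Qs in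
  (∀ (i : Fin I) → LowerCover (Q (suc i)) (Q (inject₁ i)) × HasFPPGraph (Q (suc i))) ×
  (∀ (i : Fin I) → ∃ λ h → Height (Q (inject₁ i)) h × 3 ≤ h) ×
  Height (Q (fromℕ I)) 2

Descent-cons : ∀ {n} {P Q : PosetOn n} {h} → LowerCover Q P → HasFPPGraph Q → Height P h → 3 ≤ h →
               Descent Q → Descent P
Descent-cons {Q = Q} {h} Q⋖P fppQ height 3≤h (I , Qs , links , heights , final) =
  suc I , Q ∷ Qs ,
  (λ { zero → Q⋖P , fppQ ; (suc i) → links i }) ,
  (λ { zero → h , height , 3≤h ; (suc i) → heights i }) ,
  final

descend : ∀ {n} (P : PosetOn n) → Acc _⊏_ P → HasFPPGraph P → ∀ {h} → Height P h → 2 ≤ h → Descent P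
descend _ _ _ {suc zero} _ (s≤s ())
descend P _ fpp {suc (suc zero)} height _ = 0 , [] , (λ ()) , (λ ()) , height
descend P (acc smaller) fpp {suc (suc (suc k))} height _
  with Q , Q⋖P , fppQ , h , heightQ , 2≤h ← lowerCover-withFPPGraph P fpp height =
  Descent-cons Q⋖P fppQ height (s≤s (s≤s (s≤s z≤n))) (descend Q (smaller (proj₁ Q⋖P)) fppQ heightQ 2≤h)

corollary3 : ∀ (n : ℕ) → 0 < n → ∀ (P : PosetOn n) → HasFPPGraph P →
    (∃ λ h → Height P h × 3 ≤ h) →
    Σ ℕ λ I → Σ (Fin (suc I) → PosetOn n) λ Q →
    (Q zero ≐ P) ×
    (∀ (i : Fin I) → LowerCover (Q (suc i)) (Q (inject₁ i)) × HasFPPGraph (Q (suc i))) ×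
    (∀ (i : Fin I) → ∃ λ h → Height (Q (inject₁ i)) h × 3 ≤ h) ×
    Height (Q (fromℕ I)) 2
corollary3 n _ P fpp (h , height , 3≤h)
  with I , Qs , descent ← descend P (⊏-wellFounded P) fpp height (≤-trans (n≤1+n 2) 3≤h) =
  I , P ∷ Qs , (λ _ _ → refl) , descent
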